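{- Let $\mathcal{I}$ be an ideal on $\omega$. The following are equivalent: (a) $\mathcal{I}$ is semiselective. (b) For every $a\in[\omega]^{<\omega}$ and every $A\in\mathcal{I}^{+}$, if $\{\mathcal{Q}_i\}_{i\in\omega}$ is any sequence of subsets of $[\omega]^{\omega}$ such that $[a,B]\not\subseteq\bigcap_{i\in\omega}\mathcal{Q}_i$ for all $B\in\mathcal{I}^{+}\restriction A$, then there are $i\in\omega$, $c\in[\omega]^{<\omega}$ and $C\in\mathcal{I}^{+}\restriction A$ with $|a|\le|c|\le|a|+i$ and $[c,C]\subseteq[a,A]$, such that for every $d\in[\omega]^{<\omega}$ and every $D\in\mathcal{I}^{+}\restriction C$ with $[d,D]\subseteq[c,C]$ we have $[d,D]\not\subseteq\mathcal{Q}_i$.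
   Context: An ideal on $\omega$ is a family $\mathcal{I}\subseteq\wp(\omega)$ with $\omega\notin\mathcal{I}$, $[\omega]^{<\omega}\subseteq\mathcal{I}$, closed under subsets and finite unions; $\mathcal{I}^{+}=\wp(\omega)\setminus\mathcal{I}$ and $\mathcal{I}^{+}\restriction Y=\{Z\in\mathcal{I}^+: Z\subseteq Y\}$. A set $\mathcal{D}\subseteq\mathcal{I}^+$ is dense-open on $(\mathcal{I}^+,\subseteq)$ if every $N\in\mathcal{I}^+$ has a subset $M\in\mathcal{D}$, and $\mathcal{D}$ is closed under taking subsets that lie in $\mathcal{I}^+$. For $A\subseteq\omega$, $A/m=\{k\in A:k>m\}$. $\mathcal{I}$ is semiselective if for every $A\in\mathcal{I}^+$ and every sequence $\{\mathcal{D}_n\}_{n\in\omega}$ of dense-open subsets of $(\mathcal{I}^+,\subseteq)$ there is $D_\infty\in\mathcal{I}^+\restriction A$ with $D_\infty/m\in\mathcal{D}_m$ for all $m\in D_\infty$. For finite $s\subseteq\omega$ and $B\in[\omega]^\omega$, $s\sqsubset B$ means $s$ is an initial segment of $B$ in increasing enumeration, and $[s,A]=\{B\in[\omega]^\omega: s\sqsubset B\subseteq s\cup A\}$. -}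

module Defs where

open import Level using (Level; Lift)
open import Data.Nat using (ℕ; _≤_; _<_; _+_)
open import Data.List using (List; length)
open import Data.List.Membership.Propositional using (_∈_)
open import Data.List.Relation.Unary.All using (All)
open import Data.List.Relation.Unary.Linked using (Linked)
open import Data.Product using (Σ; ∃; ∃-syntax; _×_; _,_; proj₁)
open import Data.Sum using (_⊎_)
open import Data.Unit using (⊤)
open import Data.Empty using (⊥)
open import Relation.Nullary using (¬_)
open import Function.Bundles using (_⇔_)

Subset : Set₁
Subset = ℕ → Set

Family : Set₂
Family = Subset → Set₁

ω : Subset
ω _ = ⊤

_⊆_ : Subset → Subset → Set
A ⊆ B = ∀ n → A n → B n

_∪_ : Subset → Subset → Subset
(A ∪ B) n = A n ⊎ B n

Finite : Subset → Set
Finite A = ∃[ m ] (∀ n → A n → n < m)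

Infinite : Subset → Set
Infinite A = ∀ m → ∃[ n ] (m ≤ n × A n)

_/_ : Subset → ℕ → Subset
(A / m) k = A k × m < k

_⊆F_ : Family → Family → Set₁
Q ⊆F R = ∀ B → Q B → R B

record Ideal (I : Family) : Set₂ where
  field
    ω∉ : ¬ I ω
    finite∈ : ∀ A → Finite A → I A
    ⊆-closed : ∀ A B → A ⊆ B → I B → I A
    ∪-closed : ∀ A B → I A → I B → I (A ∪ B)

Pos : Family → Subset → Set₁
Pos I A = ¬ I A

PosIn : Family → Subset → Subset → Set₁
PosIn I Y Z = Pos I Z × Z ⊆ Y

record DenseOpen (I : Family) (D : Family) : Set₂ where
  field
    ⊆Pos : ∀ N → D N → Pos I N
    dense : ∀ N → Pos I N → Σ Subset (λ M → M ⊆ N × D M)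
    open-closed : ∀ N M → D N → M ⊆ N → Pos I M → D M

Semiselective : Family → Set₂
Semiselective I =
  ∀ A → Pos I A →
  (Ds : ℕ → Family) → (∀ n → DenseOpen I (Ds n)) →
  Σ Subset (λ D∞ → PosIn I A D∞ × (∀ m → D∞ m → Ds m (D∞ / m)))

-- [ω]^{<ω}: finite subsets, represented by their strictly increasing enumeration.
FinSet : Set
FinSet = Σ (List ℕ) (Linked _<_)

∣_∣ : FinSet → ℕ
∣ s ∣ = length (proj₁ s)

_∈fin_ : ℕ → FinSet → Set
n ∈fin s = n ∈ proj₁ s

-- s ⊏ B : s is an initial segment of B (in increasing enumeration)
_⊏_ : FinSet → Subset → Set
s ⊏ B = (∀ n → n ∈fin s → B n)
      × (∀ n → B n → n ∈fin s ⊎ All (_< n) (proj₁ s))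

⟦_,_⟧ : FinSet → Subset → Family
⟦ s , A ⟧ B = Lift _ (Infinite B × s ⊏ B × B ⊆ (λ n → n ∈fin s ⊎ A n))

-- Q is a subset of [ω]^ω (as a set of sets: extensional, only infinite members)
SubsetOfInfinite : Family → Set₁
SubsetOfInfinite Q =
  (∀ B → Q B → Infinite B) × (∀ B B′ → B ⊆ B′ → B′ ⊆ B → Q B → Q B′)

⋂_ : (ℕ → Family) → Family
(⋂ Q) B = ∀ i → Q i B

ConditionB : Family → Set₂
ConditionB I =
  ∀ (a : FinSet) A → Pos I A →
  (Q : ℕ → Family) → (∀ i → SubsetOfInfinite (Q i)) →
  (∀ B → PosIn I A B → ¬ (⟦ a , B ⟧ ⊆F (⋂ Q))) →
  Σ ℕ λ i → Σ FinSet λ c → Σ Subset λ C →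
    PosIn I A C × ∣ a ∣ ≤ ∣ c ∣ × ∣ c ∣ ≤ ∣ a ∣ + i
    × (⟦ c , C ⟧ ⊆F ⟦ a , A ⟧)
    × (∀ d D → PosIn I C D → ⟦ d , D ⟧ ⊆F ⟦ c , C ⟧ → ¬ (⟦ d , D ⟧ ⊆F Q i))

-- Classical metatheory (the paper works in ZFC).
LEM : Set₃
LEM = (P : Set₂) → P ⊎ ¬ P

-- (a) ⇒ (b). For each n, "D decides [l, D] ⊆ Q i" (accepts it, or no positive subset accepts it) is
-- dense-open for the finitely many l and i bounded by n + 1, so semiselectivity gives B ⊆ A deciding
-- every extension of a by elements of B. Were all relevant extensions accepted, [a, B] ⊆ ⋂ Q would hold;
-- so some extension c is rejected for some Q i. Below a rejected l the successors n with l ⌢ n rejected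
-- form a positive set, and a second diagonalisation, splitting each such set, yields C below which every
-- extension of c stays rejected; that is (b).
--
-- (b) ⇒ (a). Put X in Q i unless X / m is positive but outside Ds m, m the i-th element of X. Without a
-- diagonal D∞ no [∅, B] lies in ⋂ Q, so (b) provides i, c and C; extending c inside C to an (i+1)-st
-- element m and shrinking C / m into Ds m gives a cylinder below [c, C] inside Q i, a contradiction.

module Submission where

open import Defs
open import Level using (Lift; lift; lower)
open import Function.Base using (_∘_)
open import Function.Bundles using (_⇔_; mk⇔)
open import Data.Nat using (ℕ; zero; suc; _≤_; _<_; _∸_; _+_; z≤n; s≤s; _≤?_)
open import Data.Nat.Properties
open import Data.Nat.Induction using (<-rec)
open import Data.List using (List; []; _∷_; _++_; [_]; _∷ʳ_; length; upTo; filter; cartesianProduct; cartesianProductWith)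
open import Data.List.Properties using (++-assoc; ++-identityʳ; length-++; ∷ʳ-injective)
open import Data.List.Extrema ≤-totalOrder using (max; xs≤max)
open import Data.List.Membership.Propositional using (_∈_; _∉_)
open import Data.List.Membership.Propositional.Properties
  using (∈-++⁺ˡ; ∈-++⁺ʳ; ∈-++⁻; ∈-upTo⁺; ∈-upTo⁻; ∈-filter⁺; ∈-filter⁻; ∈-cartesianProductWith⁺; ∈-cartesianProduct⁺)
open import Data.List.Relation.Unary.Any using (here; there)
open import Data.List.Relation.Unary.All as All using (All; []; _∷_)
open import Data.List.Relation.Unary.All.Properties using (++⁺; ++⁻ˡ)
open import Data.List.Relation.Unary.AllPairs using (AllPairs; []; _∷_)
import Data.List.Relation.Unary.AllPairs.Properties as AllPairs
open import Data.List.Relation.Unary.Linked using ([])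
open import Data.List.Relation.Unary.Linked.Properties using (AllPairs⇒Linked; Linked⇒AllPairs)
open import Data.Product using (Σ; ∃; _×_; _,_; proj₁; proj₂)
open import Data.Sum as Sum using (_⊎_; inj₁; inj₂)
open import Data.Empty using (⊥-elim)
open import Relation.Nullary using (¬_; yes; no)
open import Relation.Nullary.Decidable using (True; False; fromSum; toWitness; fromWitness; toWitnessFalse; fromWitnessFalse)
open import Relation.Binary.Definitions using (tri<; tri≈; tri>)
open import Relation.Binary.PropositionalEquality using (_≡_; refl; sym; trans; cong; subst)

private
  variable
    i j k m n x M : ℕ
    c l l′ : List ℕ
    A B C D X Y : Subset

Increasing : List ℕ → Set
Increasing = AllPairs _<_

_≺_ : List ℕ → ℕ → Set
l ≺ n = All (_< n) l

≺-max : ∀ l → max 0 l < n → l ≺ n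
≺-max l max<n = All.map (λ k≤max → ≤-<-trans k≤max max<n) (xs≤max 0 l)

≺-∉ : l ≺ n → n ∉ l
≺-∉ l≺n n∈l = <-irrefl refl (All.lookup l≺n n∈l)

≺-∷ʳ : l ≺ n → (l ∷ʳ n) ≺ suc n
≺-∷ʳ l≺n = ++⁺ (All.map m<n⇒m<1+n l≺n) (n<1+n _ ∷ [])

∈-∷ʳ⁻ : ∀ l → k ∈ l ∷ʳ n → k ∈ l ⊎ k ≡ n
∈-∷ʳ⁻ l k∈ = Sum.map₂ (λ { (here k≡n) → k≡n }) (∈-++⁻ l k∈)

length-∷ʳ : ∀ l → length (l ∷ʳ n) ≡ suc (length l)
length-∷ʳ l = trans (length-++ l) (+-comm _ 1)

Increasing-∷ʳ : Increasing l → l ≺ n → Increasing (l ∷ʳ n)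
Increasing-∷ʳ inc l≺n = AllPairs.++⁺ inc ([] ∷ []) (All.map (_∷ []) l≺n)

length≤∸ : ∀ {s u} → Increasing l → All (λ k → s ≤ k × k < u) l → length l ≤ u ∸ s
length≤∸ [] [] = z≤n
length≤∸ {x ∷ l} {s} {u} (x<l ∷ inc) ((s≤x , x<u) ∷ bounds) = begin
  suc (length l)   ≤⟨ s≤s (length≤∸ inc (All.zipWith (λ (x<k , _ , k<u) → x<k , k<u) (x<l , bounds))) ⟩
  suc (u ∸ suc x)  ≡⟨ sym (+-∸-assoc 1 x<u) ⟩
  u ∸ x            ≤⟨ ∸-monoʳ-≤ u s≤x ⟩
  u ∸ s            ∎
  where open ≤-Reasoning

length≤ : Increasing l → l ≺ M → length l ≤ M
length≤ inc l≺M = length≤∸ inc (All.map (z≤n ,_) l≺M)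

boundedLists : ℕ → ℕ → List (List ℕ)
boundedLists zero    M = [ [] ]
boundedLists (suc L) M = [] ∷ cartesianProductWith _∷_ (upTo M) (boundedLists L M)

∈-boundedLists : ∀ L → length l ≤ L → l ≺ M → l ∈ boundedLists L M
∈-boundedLists {[]}    zero    _         []          = here refl
∈-boundedLists {[]}    (suc L) _         []          = here refl
∈-boundedLists {x ∷ l} (suc L) (s≤s len) (x<M ∷ l≺M) =
  there (∈-cartesianProductWith⁺ _∷_ (∈-upTo⁺ x<M) (∈-boundedLists L len l≺M))

Increasing⇒∈-boundedLists : Increasing l → l ≺ M → l ∈ boundedLists M M
Increasing⇒∈-boundedLists inc l≺M = ∈-boundedLists _ (length≤ inc l≺M) l≺M

data Extends (G : Subset) (c : List ℕ) : List ℕ → Set where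
  base : Extends G c c
  snoc : Extends G c l → G n → l ≺ n → Extends G c (l ∷ʳ n)

Extends-increasing : Increasing c → Extends A c l → Increasing l
Extends-increasing inc base               = inc
Extends-increasing inc (snoc ext _ l≺n) = Increasing-∷ʳ (Extends-increasing inc ext) l≺n

Extends-trans : Extends A c l → Extends A l l′ → Extends A c l′
Extends-trans ext base                = ext
Extends-trans ext (snoc ext′ an l≺n) = snoc (Extends-trans ext ext′) an l≺n

Extends-mono : A ⊆ B → Extends A c l → Extends B c l
Extends-mono A⊆B base               = base
Extends-mono A⊆B (snoc ext an l≺n) = snoc (Extends-mono A⊆B ext) (A⊆B _ an) l≺n

Extends-length : Extends A c l → length c ≤ length l
Extends-length base                   = ≤-refl
Extends-length (snoc {l = l} ext _ _) =
  ≤-trans (Extends-length ext) (≤-trans (n≤1+n _) (≤-reflexive (sym (length-∷ʳ l))))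

-- On a FinSet a, ⟦ proj₁ a , A ⟧ˡ is ⟦ a , A ⟧ by definition; plain lists spare us the Linked proofs.

_⊏ˡ_ : List ℕ → Subset → Set
l ⊏ˡ X = (∀ n → n ∈ l → X n) × (∀ n → X n → n ∈ l ⊎ l ≺ n)

⟦_,_⟧ˡ : List ℕ → Subset → Family
⟦ l , A ⟧ˡ X = Lift _ (Infinite X × l ⊏ˡ X × X ⊆ (λ n → n ∈ l ⊎ A n))

⊏-cong : X ⊆ Y → Y ⊆ X → l ⊏ˡ X → l ⊏ˡ Y
⊏-cong X⊆Y Y⊆X (in-X , prefix) = (λ n → X⊆Y n ∘ in-X n) , (λ n → prefix n ∘ Y⊆X n)

⊏-head : Increasing (x ∷ l) → (x ∷ l) ⊏ˡ X → X n → ¬ n < x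
⊏-head (x<l ∷ _) (_ , prefix) xn n<x with prefix _ xn
... | inj₁ (here refl) = <-irrefl refl n<x
... | inj₁ (there n∈l) = <-asym n<x (All.lookup x<l n∈l)
... | inj₂ (x<n ∷ _)   = <-asym n<x x<n

⊏-tail : Increasing (x ∷ l) → (x ∷ l) ⊏ˡ X → l ⊏ˡ (λ n → X n × x < n)
⊏-tail (x<l ∷ _) (in-X , prefix) = (λ n n∈l → in-X n (there n∈l) , All.lookup x<l n∈l) , tail-prefix
  where
  tail-prefix : ∀ n → _ × _ < n → n ∈ _ ⊎ _ ≺ n
  tail-prefix n (xn , x<n) with prefix n xn
  ... | inj₁ (here refl)  = ⊥-elim (<-irrefl refl x<n)
  ... | inj₁ (there n∈l)  = inj₁ n∈l
  ... | inj₂ (_ ∷ l≺n)    = inj₂ l≺n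

⊏-unique : Increasing l → Increasing l′ → l ⊏ˡ X → l′ ⊏ˡ X → length l ≡ length l′ → l ≡ l′
⊏-unique [] [] _ _ _ = refl
⊏-unique {x ∷ l} {y ∷ l′} inc@(_ ∷ incₗ) inc′@(_ ∷ incₗ′) l⊏X l′⊏X len with <-cmp x y
... | tri< x<y _ _ = ⊥-elim (⊏-head inc′ l′⊏X (proj₁ l⊏X x (here refl)) x<y)
... | tri> _ _ y<x = ⊥-elim (⊏-head inc l⊏X (proj₁ l′⊏X y (here refl)) y<x)
... | tri≈ _ refl _ =
  cong (x ∷_) (⊏-unique incₗ incₗ′ (⊏-tail inc l⊏X) (⊏-tail inc′ l′⊏X) (suc-injective len))

∅ : FinSet
∅ = [] , []

-- m is the i-th element (counting from 0) of X
Nth : Subset → ℕ → ℕ → Set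
Nth X i m = ∃ λ l → length l ≡ i × Increasing l × l ≺ m × (l ∷ʳ m) ⊏ˡ X

Nth-unique : Nth X i m → Nth X i n → m ≡ n
Nth-unique (l , refl , inc , l≺m , l⊏X) (l′ , len′ , inc′ , l′≺n , l′⊏X) =
  proj₂ (∷ʳ-injective l l′ (⊏-unique (Increasing-∷ʳ inc l≺m) (Increasing-∷ʳ inc′ l′≺n) l⊏X l′⊏X
    (trans (length-∷ʳ l) (trans (cong suc (sym len′)) (sym (length-∷ʳ l′))))))

Nth-cong : X ⊆ Y → Y ⊆ X → Nth X i m → Nth Y i m
Nth-cong X⊆Y Y⊆X (l , len , inc , l≺m , l⊏X) = l , len , inc , l≺m , ⊏-cong X⊆Y Y⊆X l⊏X

pattern cylinder inf l⊏X X⊆ = lift (inf , l⊏X , X⊆)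

⟦⟧-mono : A ⊆ B → ⟦ l , A ⟧ˡ ⊆F ⟦ l , B ⟧ˡ
⟦⟧-mono A⊆B X (cylinder inf l⊏X X⊆) = cylinder inf l⊏X (λ n → Sum.map₂ (A⊆B n) ∘ X⊆ n)

⟦⟧-same : (∀ {k} → k ∈ l → k ∈ l′) → (∀ {k} → k ∈ l′ → k ∈ l) → ⟦ l , A ⟧ˡ ⊆F ⟦ l′ , A ⟧ˡ
⟦⟧-same l⊆l′ l′⊆l X (cylinder inf (in-X , prefix) X⊆) =
  cylinder inf ((λ n → in-X n ∘ l′⊆l) , λ n → Sum.map l⊆l′ (λ l≺n → All.tabulate (All.lookup l≺n ∘ l′⊆l)) ∘ prefix n)
    (λ n → Sum.map₁ l⊆l′ ∘ X⊆ n)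

⟦∷ʳ⟧⊆⟦⟧ : A n → l ≺ n → C ⊆ A → ⟦ l ∷ʳ n , C ⟧ˡ ⊆F ⟦ l , A ⟧ˡ
⟦∷ʳ⟧⊆⟦⟧ {A} {n} {l} an l≺n C⊆A X (cylinder inf (in-X , prefix) X⊆) =
  cylinder inf ((λ k → in-X k ∘ ∈-++⁺ˡ) , prefix′) X⊆′
  where
  prefix′ : ∀ k → X k → k ∈ l ⊎ l ≺ k
  prefix′ k xk with prefix k xk
  ... | inj₂ l∷ʳn≺k = inj₂ (++⁻ˡ l l∷ʳn≺k)
  ... | inj₁ k∈ with ∈-∷ʳ⁻ l k∈
  ...   | inj₁ k∈l = inj₁ k∈l
  ...   | inj₂ refl = inj₂ l≺n
  X⊆′ : ∀ k → X k → k ∈ l ⊎ A k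
  X⊆′ k xk with X⊆ k xk
  ... | inj₂ ck = inj₂ (C⊆A k ck)
  ... | inj₁ k∈ with ∈-∷ʳ⁻ l k∈
  ...   | inj₁ k∈l = inj₁ k∈l
  ...   | inj₂ refl = inj₂ an

⟦⟧-Extends : Extends A c l → C ⊆ A → ⟦ l , C ⟧ˡ ⊆F ⟦ c , A ⟧ˡ
⟦⟧-Extends base              C⊆A = ⟦⟧-mono C⊆A
⟦⟧-Extends (snoc ext an l≺n) C⊆A X = ⟦⟧-Extends ext (λ _ a → a) X ∘ ⟦∷ʳ⟧⊆⟦⟧ an l≺n C⊆A X

⟦⟧-/ : m ∈ l → ⟦ l , B ⟧ˡ ⊆F ⟦ l , B / m ⟧ˡ
⟦⟧-/ {m} {l} {B} m∈l X (cylinder inf (in-X , prefix) X⊆) = cylinder inf (in-X , prefix) X⊆′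
  where
  X⊆′ : ∀ k → X k → k ∈ l ⊎ (B / m) k
  X⊆′ k xk with prefix k xk | X⊆ k xk
  ... | inj₁ k∈l | _        = inj₁ k∈l
  ... | inj₂ _   | inj₁ k∈l = inj₁ k∈l
  ... | inj₂ l≺k | inj₂ bk  = inj₂ (bk , All.lookup l≺k m∈l)

⟦∷ʳ⟧-/⊆ : l ≺ m → ⟦ l ∷ʳ m , D ⟧ˡ X → (X / m) ⊆ D
⟦∷ʳ⟧-/⊆ {l} l≺m (cylinder _ _ X⊆) k (xk , m<k) with X⊆ k xk
... | inj₂ dk = dk
... | inj₁ k∈ with ∈-∷ʳ⁻ l k∈
...   | inj₁ k∈l = ⊥-elim (<-asym m<k (All.lookup l≺m k∈l))
...   | inj₂ refl = ⊥-elim (<-irrefl refl m<k)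

⟦⟧-canonical : Infinite (λ k → D k × l ≺ k) → ⟦ l , D ⟧ˡ (λ k → k ∈ l ⊎ (D k × l ≺ k))
⟦⟧-canonical inf =
  cylinder (λ m → let (n , m≤n , dn) = inf m in n , m≤n , inj₂ dn)
    ((λ _ → inj₁) , λ _ → Sum.map₂ proj₂)
    (λ _ → Sum.map₂ proj₁)

module Classical (lem : LEM) where

  em₁ : (P : Set₁) → P ⊎ ¬ P
  em₁ P = Sum.map lower (λ ¬P p → ¬P (lift p)) (lem (Lift _ P))

  em₀ : (P : Set) → P ⊎ ¬ P
  em₀ P = Sum.map lower (λ ¬P p → ¬P (lift p)) (lem (Lift _ P))

  least : (P : ℕ → Set) → P n → ∃ λ m → P m × ∀ k → P k → m ≤ k
  least {n} P = <-rec (λ n → P n → ∃ λ m → P m × ∀ k → P k → m ≤ k) step n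
    where
    step : ∀ n → (∀ {k} → k < n → P k → ∃ λ m → P m × ∀ k → P k → m ≤ k) → P n → ∃ λ m → P m × ∀ k → P k → m ≤ k
    step n smaller pn with em₀ (∃ λ k → k < n × P k)
    ... | inj₁ (k , k<n , pk) = smaller k<n pk
    ... | inj₂ none           = n , pn , λ k pk → ≮⇒≥ λ k<n → none (k , k<n , pk)

  ⟦⟧-next : ⟦ l , B ⟧ˡ X → ∃ λ m → B m × l ≺ m × ⟦ l ∷ʳ m , B ⟧ˡ X
  ⟦⟧-next {l} {B} {X} (cylinder inf (in-X , prefix) X⊆) with inf (suc (max 0 l))
  ... | n , max<n , xn with least (λ k → X k × l ≺ k) (xn , ≺-max l max<n)
  ...   | m , (xm , l≺m) , minimal = m , bm , l≺m , cylinder inf (in-X′ , prefix′) X⊆′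
    where
    bm : B m
    bm = Sum.[ (λ m∈l → ⊥-elim (≺-∉ l≺m m∈l)) , (λ bm → bm) ]′ (X⊆ m xm)
    in-X′ : ∀ k → k ∈ l ∷ʳ m → X k
    in-X′ k k∈ = Sum.[ in-X k , (λ { refl → xm }) ]′ (∈-∷ʳ⁻ l k∈)
    prefix′ : ∀ k → X k → k ∈ l ∷ʳ m ⊎ (l ∷ʳ m) ≺ k
    prefix′ k xk with prefix k xk
    ... | inj₁ k∈l = inj₁ (∈-++⁺ˡ k∈l)
    ... | inj₂ l≺k with m≤n⇒m<n∨m≡n (minimal k (xk , l≺k))
    ...   | inj₁ m<k  = inj₂ (++⁺ l≺k (m<k ∷ []))
    ...   | inj₂ refl = inj₁ (∈-++⁺ʳ l (here refl))
    X⊆′ : ∀ k → X k → k ∈ l ∷ʳ m ⊎ B k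
    X⊆′ k = Sum.map₁ ∈-++⁺ˡ ∘ X⊆ k

  segment : ⟦ l , B ⟧ˡ X → ∀ j → ∃ λ l′ → Extends B l l′ × length l′ ≡ length l + j × ⟦ l′ , B ⟧ˡ X
  segment x zero = _ , base , sym (+-identityʳ _) , x
  segment x (suc j) with segment x j
  ... | l′ , ext , len , x′ with ⟦⟧-next x′
  ...   | m , bm , l′≺m , x″ =
    l′ ∷ʳ m , snoc ext bm l′≺m , trans (length-∷ʳ l′) (trans (cong suc len) (sym (+-suc _ j))) , x″

  ∈⇒Nth : X m → ∃ λ i → Nth X i m
  ∈⇒Nth {X} {m} xm = length below , below , refl , increasing , below≺m , (in-X , prefix)
    where
    X? = λ k → fromSum (em₀ (X k))
    below = filter X? (upTo m)
    increasing : Increasing below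
    increasing = AllPairs.filter⁺ X? (AllPairs.applyUpTo⁺₁ (λ k → k) m (λ i<j _ → i<j))
    below≺m : below ≺ m
    below≺m = All.tabulate (∈-upTo⁻ ∘ proj₁ ∘ ∈-filter⁻ X? {xs = upTo m})
    in-X : ∀ k → k ∈ below ∷ʳ m → X k
    in-X k k∈ = Sum.[ proj₂ ∘ ∈-filter⁻ X? {xs = upTo m} , (λ { refl → xm }) ]′ (∈-∷ʳ⁻ below k∈)
    prefix : ∀ k → X k → k ∈ below ∷ʳ m ⊎ (below ∷ʳ m) ≺ k
    prefix k xk with <-cmp k m
    ... | tri< k<m _ _  = inj₁ (∈-++⁺ˡ (∈-filter⁺ X? (∈-upTo⁺ k<m) xk))
    ... | tri≈ _ refl _ = inj₁ (∈-++⁺ʳ below (here refl))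
    ... | tri> _ _ m<k  = inj₂ (++⁺ (All.map (λ j<m → <-trans j<m m<k) below≺m) (m<k ∷ []))

  module _ {I : Family} (ideal : Ideal I) where
    open Ideal ideal

    Pos-mono : A ⊆ B → Pos I A → Pos I B
    Pos-mono A⊆B posA iB = posA (⊆-closed _ _ A⊆B iB)

    Pos-∪ : Pos I X → X ⊆ (A ∪ B) → Pos I A ⊎ Pos I B
    Pos-∪ {A = A} posX X⊆A∪B with em₁ (I A)
    ... | inj₁ iA   = inj₂ λ iB → posX (⊆-closed _ _ X⊆A∪B (∪-closed _ _ iA iB))
    ... | inj₂ posA = inj₁ posA

    Pos-≥ : Pos I X → ∀ b → Pos I (λ n → X n × b ≤ n)
    Pos-≥ {X} posX b with Pos-∪ posX split
      where
      split : X ⊆ ((λ n → X n × b ≤ n) ∪ (λ n → n < b))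
      split n xn with b ≤? n
      ... | yes b≤n = inj₁ (xn , b≤n)
      ... | no b≰n  = inj₂ (≰⇒> b≰n)
    ... | inj₁ pos      = pos
    ... | inj₂ posBelow = ⊥-elim (posBelow (finite∈ _ (b , λ _ n<b → n<b)))

    Pos-/ : Pos I X → ∀ m → Pos I (X / m)
    Pos-/ posX m = Pos-≥ posX (suc m)

    Pos-≺ : Pos I X → ∀ l → Pos I (λ n → X n × l ≺ n)
    Pos-≺ posX l = Pos-mono (λ _ (xn , max<n) → xn , ≺-max l max<n) (Pos-≥ posX (suc (max 0 l)))

    Pos⇒Infinite : Pos I X → Infinite X
    Pos⇒Infinite {X} posX m with em₀ (∃ λ n → m ≤ n × X n)
    ... | inj₁ above = above
    ... | inj₂ none  = ⊥-elim (posX (finite∈ X (m , λ n xn → ≰⇒> λ m≤n → none (n , m≤n , xn))))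

    Dense : Family → Set₁
    Dense F = ∀ N → Pos I N → Σ Subset λ M → M ⊆ N × Pos I M × F M

    Open : Family → Set₁
    Open F = ∀ {N M} → M ⊆ N → F N → F M

    dense-∀∈ : {K : Set} (F : K → Family) → (∀ k → Dense (F k)) → (∀ k → Open (F k)) →
               ∀ ks → Dense (λ D → ∀ {k} → k ∈ ks → F k D)
    dense-∀∈ F F-dense F-open [] N posN = N , (λ _ n → n) , posN , λ ()
    dense-∀∈ F F-dense F-open (k ∷ ks) N posN =
      let (M , M⊆N , posM , FkM)         = F-dense k N posN
          (M′ , M′⊆M , posM′ , FksM′) = dense-∀∈ F F-dense F-open ks M posM
      in  M′ , (λ n → M⊆N n ∘ M′⊆M n) , posM′ , λ { (here refl) → F-open k M′⊆M FkM ; (there k∈) → FksM′ k∈ }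

    open-∀∈ : {K : Set} (F : K → Family) → (∀ k → Open (F k)) → ∀ ks → Open (λ D → ∀ {k} → k ∈ ks → F k D)
    open-∀∈ F F-open ks M⊆N FN k∈ = F-open _ M⊆N (FN k∈)

    denseOpen : {F : Family} → Dense F → Open F → DenseOpen I (λ D → Pos I D × F D)
    denseOpen F-dense F-open = record
      { ⊆Pos        = λ _ → proj₁
      ; dense       = λ N posN → let (M , M⊆N , posM , FM) = F-dense N posN in M , M⊆N , posM , FM
      ; open-closed = λ _ _ (_ , FN) M⊆N posM → posM , F-open M⊆N FN
      }

    Accepts : List ℕ → Family → Subset → Set₁
    Accepts l P D = ⟦ l , D ⟧ˡ ⊆F P

    Rejects : List ℕ → Family → Subset → Set₁
    Rejects l P D = ∀ D′ → PosIn I D D′ → ¬ Accepts l P D′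

    Decides : List ℕ → Family → Family
    Decides l P D = Accepts l P D ⊎ Rejects l P D

    Decides-dense : ∀ l P → Dense (Decides l P)
    Decides-dense l P N posN with em₁ (Σ Subset λ D → PosIn I N D × Accepts l P D)
    ... | inj₁ (D , (posD , D⊆N) , acc) = D , D⊆N , posD , inj₁ acc
    ... | inj₂ none                     = N , (λ _ n → n) , posN , inj₂ λ D posD acc → none (D , posD , acc)

    Decides-open : ∀ l P → Open (Decides l P)
    Decides-open l P M⊆N (inj₁ acc) = inj₁ λ X → acc X ∘ ⟦⟧-mono M⊆N X
    Decides-open l P M⊆N (inj₂ rej) = inj₂ λ D (posD , D⊆M) → rej D (posD , λ n → M⊆N n ∘ D⊆M n)

    Decides-/ : ∀ {P} → m ∈ l → Decides l P (B / m) → Decides l P B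
    Decides-/ m∈l (inj₁ acc) = inj₁ λ X → acc X ∘ ⟦⟧-/ m∈l X
    Decides-/ {m} m∈l (inj₂ rej) = inj₂ λ D (posD , D⊆B) acc →
      rej (D / m) (Pos-/ posD m , λ n (dn , m<n) → D⊆B n dn , m<n) λ X → acc X ∘ ⟦⟧-mono (λ _ → proj₁) X

    StronglyRejects : List ℕ → Family → Subset → Set₁
    StronglyRejects c P C = ∀ (d : FinSet) D → PosIn I C D → ⟦ d , D ⟧ ⊆F ⟦ c , C ⟧ˡ → ¬ (⟦ d , D ⟧ ⊆F P)

    module Rejection (ss : Semiselective I) (P : Family) {B : Subset} (posB : Pos I B)
                     {c : List ℕ} (c-increasing : Increasing c)
                     (decides : ∀ {l n} → Extends B c l → B n → l ≺ n → Decides (l ∷ʳ n) P B)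
                     (c-rejected : Rejects c P B) where

      Rejected : List ℕ → Set₁
      Rejected l = Rejects l P B

      -- Rejected is Set₁-valued; deciding it by excluded middle makes these genuine subsets of ω.
      rejecting accepting : List ℕ → Subset
      rejecting l n = B n × l ≺ n × True (fromSum (em₁ (Rejected (l ∷ʳ n))))
      accepting l n = B n × l ≺ n × False (fromSum (em₁ (Rejected (l ∷ʳ n))))

      accepting-small : Extends B c l → Rejected l → ¬ Pos I (accepting l)
      accepting-small {l} ext rej posAcc = rej (accepting l) (posAcc , λ _ → proj₁) all-accepted
        where
        all-accepted : Accepts l P (accepting l)
        all-accepted X x with ⟦⟧-next x
        ... | m , (bm , _ , not-rejected) , l≺m , x′ with decides ext bm l≺m
        ...   | inj₁ acc = acc X (⟦⟧-mono {A = accepting l} (λ _ → proj₁) X x′)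
        ...   | inj₂ rej′ = ⊥-elim (toWitnessFalse not-rejected rej′)

      rejecting-large : Extends B c l → Rejected l → Pos I (rejecting l)
      rejecting-large {l} ext rej with Pos-∪ (Pos-≺ posB l) split
        where
        split : (λ n → B n × l ≺ n) ⊆ (rejecting l ∪ accepting l)
        split n (bn , l≺n) =
          Sum.map (λ r → bn , l≺n , fromWitness r) (λ ¬r → bn , l≺n , fromWitnessFalse ¬r) (em₁ (Rejected (l ∷ʳ n)))
      ... | inj₁ posRej = posRej
      ... | inj₂ posAcc = ⊥-elim (accepting-small ext rej posAcc)

      Splits : List ℕ → Family
      Splits l D = Lift _ (D ⊆ rejecting l ⊎ (∀ n → D n → ¬ rejecting l n))

      Splits-dense : ∀ l → Dense (Splits l)
      Splits-dense l N posN with Pos-∪ posN (λ n nn → Sum.map (nn ,_) (nn ,_) (em₀ (rejecting l n)))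
      ... | inj₁ pos = _ , (λ _ → proj₁) , pos , lift (inj₁ λ _ → proj₂)
      ... | inj₂ pos = _ , (λ _ → proj₁) , pos , lift (inj₂ λ _ → proj₂)

      Splits-open : ∀ l → Open (Splits l)
      Splits-open l M⊆N (lift split) =
        lift (Sum.map (λ N⊆R n → N⊆R n ∘ M⊆N n) (λ N∩R≡∅ n → N∩R≡∅ n ∘ M⊆N n) split)

      SplitsAll : ℕ → Family
      SplitsAll k D = ∀ {l} → l ∈ boundedLists (suc k) (suc k) → Splits l D

      diagonal : Σ Subset λ G → PosIn I (rejecting c) G × (∀ k → G k → Pos I (G / k) × SplitsAll k (G / k))
      diagonal = ss (rejecting c) (rejecting-large base c-rejected) (λ k D → Pos I D × SplitsAll k D)
        λ k → denseOpen (dense-∀∈ Splits Splits-dense Splits-open _) (open-∀∈ Splits Splits-open _)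

      G : Subset
      G = proj₁ diagonal

      posG : Pos I G
      posG = proj₁ (proj₁ (proj₂ diagonal))

      G⊆rejecting : G ⊆ rejecting c
      G⊆rejecting = proj₂ (proj₁ (proj₂ diagonal))

      G⊆B : G ⊆ B
      G⊆B n = proj₁ ∘ G⊆rejecting n

      G/k-splits : ∀ k → G k → SplitsAll k (G / k)
      G/k-splits k = proj₂ ∘ proj₂ (proj₂ diagonal) k

      -- With k the last entry, G / k lies inside or wholly outside the rejecting successors; outside, it
      -- would be a positive set of accepted successors, and the list would be accepted.
      rejects-∷ʳ : Extends G c l → Rejected l → G n → l ≺ n → Rejected (l ∷ʳ n)
      rejects-∷ʳ base _ gn _ = toWitness (proj₂ (proj₂ (G⊆rejecting _ gn)))
      rejects-∷ʳ {n = n} (snoc {l} {k} ext gk l≺k) rej gn l∷ʳk≺n =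
        by-split (G/k-splits k gk (Increasing⇒∈-boundedLists l∷ʳk-increasing (≺-∷ʳ l≺k)))
        where
        l∷ʳk-increasing : Increasing (l ∷ʳ k)
        l∷ʳk-increasing = Extends-increasing c-increasing (Extends-mono G⊆B (snoc ext gk l≺k))
        above-k : ∀ {n′} → k < n′ → (l ∷ʳ k) ≺ n′
        above-k k<n′ = ++⁺ (All.map (λ j<k → <-trans j<k k<n′) l≺k) (k<n′ ∷ [])
        by-split : Splits (l ∷ʳ k) (G / k) → Rejected (l ∷ʳ k ∷ʳ n)
        by-split (lift (inj₁ G/k⊆rejecting)) =
          toWitness (proj₂ (proj₂ (G/k⊆rejecting n (gn , All.lookup l∷ʳk≺n (∈-++⁺ʳ l (here refl))))))
        by-split (lift (inj₂ G/k-avoids)) =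
          ⊥-elim (accepting-small (Extends-mono G⊆B (snoc ext gk l≺k)) rej (Pos-mono G/k⊆accepting (Pos-/ posG k)))
          where
          G/k⊆accepting : (G / k) ⊆ accepting (l ∷ʳ k)
          G/k⊆accepting n′ (gn′ , k<n′) =
            G⊆B n′ gn′ , above-k k<n′ ,
            fromWitnessFalse λ r → G/k-avoids n′ (gn′ , k<n′) (G⊆B n′ gn′ , above-k k<n′ , fromWitness r)

      rejects-++ : ∀ e → Extends G c l → Rejected l → Increasing e → All G e → All (l ≺_) e → Rejected (l ++ e)
      rejects-++ {l} [] _ rej _ _ _ = subst Rejected (sym (++-identityʳ l)) rej
      rejects-++ {l} (n ∷ e) ext rej (n<e ∷ inc) (gn ∷ ge) (l≺n ∷ l≺e) =
        subst Rejected (++-assoc l [ n ] e)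
          (rejects-++ e (snoc ext gn l≺n) (rejects-∷ʳ ext rej gn l≺n) inc ge
            (All.zipWith (λ (l≺k , n<k) → ++⁺ l≺k (n<k ∷ [])) (l≺e , n<e)))

      -- A member X₁ of [d, D] ⊆ [c, G] shows that d is c followed by entries in G, so d is rejected.
      strongly-rejects : StronglyRejects c P G
      strongly-rejects (d , d-linked) D (posD , D⊆G) [d,D]⊆[c,G] [d,D]⊆P =
        rejects-++ e base c-rejected e-increasing (All.tabulate e⊆G) (All.tabulate e-above)
          D (posD , λ n → G⊆B n ∘ D⊆G n) λ X → [d,D]⊆P X ∘ ⟦⟧-same c++e⊆d d⊆c++e X
        where
        X₁ : Subset
        X₁ k = k ∈ d ⊎ ((D k × c ≺ k) × d ≺ k)
        x₁ : ⟦ c , G ⟧ˡ X₁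
        x₁ = [d,D]⊆[c,G] X₁ (⟦⟧-mono {A = λ k → D k × c ≺ k} (λ _ → proj₁) X₁ (⟦⟧-canonical (Pos⇒Infinite (Pos-≺ (Pos-≺ posD c) d))))
        c≺? = λ k → All.all? (_<? k) c
        e = filter c≺? d
        e-increasing : Increasing e
        e-increasing = AllPairs.filter⁺ c≺? (Linked⇒AllPairs <-trans d-linked)
        e-above : ∀ {k} → k ∈ e → c ≺ k
        e-above = proj₂ ∘ ∈-filter⁻ c≺? {xs = d}
        e⊆G : ∀ {k} → k ∈ e → G k
        e⊆G {k} k∈e = Sum.[ (λ k∈c → ⊥-elim (≺-∉ (e-above k∈e) k∈c)) , (λ gk → gk) ]′
          (proj₂ (proj₂ (lower x₁)) k (inj₁ (proj₁ (∈-filter⁻ c≺? {xs = d} k∈e))))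
        c⊆d : ∀ {k} → k ∈ c → k ∈ d
        c⊆d {k} k∈c = Sum.[ (λ k∈d → k∈d) , (λ ((_ , c≺k) , _) → ⊥-elim (≺-∉ c≺k k∈c)) ]′
          (proj₁ (proj₁ (proj₂ (lower x₁))) k k∈c)
        c++e⊆d : ∀ {k} → k ∈ c ++ e → k ∈ d
        c++e⊆d k∈ = Sum.[ c⊆d , proj₁ ∘ ∈-filter⁻ c≺? {xs = d} ]′ (∈-++⁻ c k∈)
        d⊆c++e : ∀ {k} → k ∈ d → k ∈ c ++ e
        d⊆c++e {k} k∈d = Sum.[ ∈-++⁺ˡ , ∈-++⁺ʳ c ∘ ∈-filter⁺ c≺? k∈d ]′
          (proj₂ (proj₁ (proj₂ (lower x₁))) k (inj₁ k∈d))

      strongly-rejecting : Σ Subset λ G → PosIn I B G × StronglyRejects c P G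
      strongly-rejecting = G , (posG , G⊆B) , strongly-rejects

    module Forward (ss : Semiselective I) (a : FinSet) {A : Subset} (posA : Pos I A) (Q : ℕ → Family) where

      Witness : Set₁
      Witness = Σ ℕ λ i → Σ FinSet λ c → Σ Subset λ C →
        PosIn I A C × ∣ a ∣ ≤ ∣ c ∣ × ∣ c ∣ ≤ ∣ a ∣ + i × (⟦ c , C ⟧ ⊆F ⟦ a , A ⟧) × StronglyRejects (proj₁ c) (Q i) C

      a-increasing : Increasing (proj₁ a)
      a-increasing = Linked⇒AllPairs <-trans (proj₂ a)

      tasks : ℕ → List (List ℕ × ℕ)
      tasks n = cartesianProduct (boundedLists (suc n) (suc n)) (upTo (suc (suc n)))

      DecidesTask : List ℕ × ℕ → Family
      DecidesTask (l , i) = Decides l (Q i)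

      DecidesTasks : ℕ → Family
      DecidesTasks n D = Pos I D × (∀ {t} → t ∈ tasks n → DecidesTask t D)

      A₀ : Σ Subset λ A₀ → A₀ ⊆ A × Pos I A₀ × Decides (proj₁ a) (Q 0) A₀
      A₀ = Decides-dense _ _ A posA

      diagonal : Σ Subset λ D∞ → PosIn I (proj₁ A₀) D∞ × (∀ n → D∞ n → DecidesTasks n (D∞ / n))
      diagonal = ss (proj₁ A₀) (proj₁ (proj₂ (proj₂ A₀))) DecidesTasks λ n →
        denseOpen (dense-∀∈ DecidesTask (λ (l , i) → Decides-dense l (Q i)) (λ (l , i) → Decides-open l (Q i)) (tasks n))
                  (open-∀∈ DecidesTask (λ (l , i) → Decides-open l (Q i)) (tasks n))

      D∞ : Subset
      D∞ = proj₁ diagonal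

      posD∞ : Pos I D∞
      posD∞ = proj₁ (proj₁ (proj₂ diagonal))

      D∞⊆A : D∞ ⊆ A
      D∞⊆A n = proj₁ (proj₂ A₀) n ∘ proj₂ (proj₁ (proj₂ diagonal)) n

      D∞/n-decides : ∀ n → D∞ n → ∀ {t} → t ∈ tasks n → DecidesTask t (D∞ / n)
      D∞/n-decides n = proj₂ ∘ proj₂ (proj₂ diagonal) n

      D∞-decides-a : Decides (proj₁ a) (Q 0) D∞
      D∞-decides-a = Decides-open _ _ (proj₂ (proj₁ (proj₂ diagonal))) (proj₂ (proj₂ (proj₂ A₀)))

      decides-∷ʳ : Extends D∞ (proj₁ a) l → D∞ n → l ≺ n → i ≤ length (l ∷ʳ n) → Decides (l ∷ʳ n) (Q i) D∞
      decides-∷ʳ {l} {n} ext bn l≺n i≤ =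
        Decides-/ (∈-++⁺ʳ l (here refl)) (D∞/n-decides n bn (∈-cartesianProduct⁺
          (Increasing⇒∈-boundedLists increasing (≺-∷ʳ l≺n))
          (∈-upTo⁺ (s≤s (≤-trans i≤ (length≤ increasing (≺-∷ʳ l≺n)))))))
        where
        increasing = Increasing-∷ʳ (Extends-increasing a-increasing ext) l≺n

      accepts : ¬ Witness → Extends D∞ (proj₁ a) l → i ≤ length l → length l ≤ ∣ a ∣ + i →
                Decides l (Q i) D∞ → Accepts l (Q i) D∞
      accepts _ _ _ _ (inj₁ acc) = acc
      accepts {l} {i} no-witness ext i≤ len≤ (inj₂ rej) =
        ⊥-elim (no-witness (i , (l , AllPairs⇒Linked increasing) , G , (posG , G⊆A) ,
                            Extends-length ext , len≤ , ⟦⟧-Extends (Extends-mono D∞⊆A ext) G⊆A , strongly-rejects))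
        where
        increasing = Extends-increasing a-increasing ext
        extensions-decided : ∀ {l′ n} → Extends D∞ l l′ → D∞ n → l′ ≺ n → Decides (l′ ∷ʳ n) (Q i) D∞
        extensions-decided {l′} ext′ bn l′≺n =
          decides-∷ʳ (Extends-trans ext ext′) bn l′≺n
            (≤-trans i≤ (≤-trans (Extends-length ext′) (≤-trans (n≤1+n _) (≤-reflexive (sym (length-∷ʳ l′))))))
        open Rejection ss (Q i) posD∞ increasing extensions-decided rej using (G; posG; G⊆B; strongly-rejects)
        G⊆A : G ⊆ A
        G⊆A n = D∞⊆A n ∘ G⊆B n

      inside : ¬ Witness → ⟦ a , D∞ ⟧ ⊆F (⋂ Q)
      inside no-witness X x zero = accepts no-witness base z≤n (m≤m+n _ 0) D∞-decides-a X x
      inside no-witness X x (suc j) with segment x j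
      ... | l , ext , len , x′ with ⟦⟧-next x′
      ...   | m , bm , l≺m , x″ =
        accepts no-witness (snoc ext bm l≺m) i≤ (≤-reflexive length≡) (decides-∷ʳ ext bm l≺m i≤) X x″
        where
        length≡ : length (l ∷ʳ m) ≡ ∣ a ∣ + suc j
        length≡ = trans (length-∷ʳ l) (trans (cong suc len) (sym (+-suc _ j)))
        i≤ : suc j ≤ length (l ∷ʳ m)
        i≤ = ≤-trans (m≤n+m (suc j) ∣ a ∣) (≤-reflexive (sym length≡))

    semiselective⇒conditionB : Semiselective I → ConditionB I
    semiselective⇒conditionB ss a A posA Q _ a-avoids with em₁ (Forward.Witness ss a posA Q)
    ... | inj₁ witness    = witness
    ... | inj₂ no-witness = ⊥-elim (a-avoids D∞ (posD∞ , D∞⊆A) (inside no-witness))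
      where open Forward ss a posA Q

    module Backward (Ds : ℕ → Family) (Ds-denseOpen : ∀ n → DenseOpen I (Ds n)) where

      Q : ℕ → Family
      Q i X = Infinite X × (∀ m → Nth X i m → I (X / m) ⊎ Ds m (X / m))

      Q-subsetOfInfinite : ∀ i → SubsetOfInfinite (Q i)
      Q-subsetOfInfinite i = (λ _ → proj₁) , λ X Y X⊆Y Y⊆X (inf , good) →
        (λ n → let (k , n≤k , xk) = inf n in k , n≤k , X⊆Y k xk) ,
        λ m nth → Sum.map (⊆-closed _ _ (/-mono Y⊆X)) (same-tail X⊆Y Y⊆X) (good m (Nth-cong Y⊆X X⊆Y nth))
        where
        /-mono : X ⊆ Y → (X / m) ⊆ (Y / m)
        /-mono X⊆Y n (xn , m<n) = X⊆Y n xn , m<n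
        same-tail : X ⊆ Y → Y ⊆ X → Ds m (X / m) → Ds m (Y / m)
        same-tail {m = m} X⊆Y Y⊆X dsX =
          DenseOpen.open-closed (Ds-denseOpen m) _ _ dsX (/-mono Y⊆X)
            (Pos-mono (/-mono X⊆Y) (DenseOpen.⊆Pos (Ds-denseOpen m) _ dsX))

      Q-meets-every-cylinder : Increasing c → Pos I C → length c ≤ i → ¬ StronglyRejects c (Q i) C
      Q-meets-every-cylinder {c} {C} {i} c-increasing posC |c|≤i C-strongly-rejects with
        segment (⟦⟧-canonical (Pos⇒Infinite (Pos-≺ posC c))) (i ∸ length c)
      ... | l , ext , len , x with ⟦⟧-next x
      ...   | m , cm , l≺m , _ with DenseOpen.dense (Ds-denseOpen m) (C / m) (Pos-/ posC m)
      ...     | M , M⊆C/m , dsM =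
        C-strongly-rejects (l ∷ʳ m , AllPairs⇒Linked (Increasing-∷ʳ l-increasing l≺m)) M
          (DenseOpen.⊆Pos (Ds-denseOpen m) M dsM , M⊆C) (⟦⟧-Extends (snoc ext cm l≺m) M⊆C) [l∷ʳm,M]⊆Q
        where
        M⊆C : M ⊆ C
        M⊆C n = proj₁ ∘ M⊆C/m n
        l-increasing : Increasing l
        l-increasing = Extends-increasing c-increasing ext
        [l∷ʳm,M]⊆Q : ⟦ l ∷ʳ m , M ⟧ˡ ⊆F Q i
        [l∷ʳm,M]⊆Q X y@(cylinder inf l∷ʳm⊏X _) = inf , λ m′ nth′ →
          subst (λ m → I (X / m) ⊎ Ds m (X / m)) (Nth-unique nth nth′) (Sum.map₂ tail-in-Ds (em₁ (I (X / m))))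
          where
          nth : Nth X i m
          nth = l , trans len (m+[n∸m]≡n |c|≤i) , l-increasing , l≺m , l∷ʳm⊏X
          tail-in-Ds : Pos I (X / m) → Ds m (X / m)
          tail-in-Ds = DenseOpen.open-closed (Ds-denseOpen m) M (X / m) dsM (⟦∷ʳ⟧-/⊆ l≺m y)

      Diagonal : Subset → Set₁
      Diagonal A = Σ Subset λ D∞ → PosIn I A D∞ × (∀ m → D∞ m → Ds m (D∞ / m))

      no-cylinder-inside : ¬ Diagonal A → ∀ B → PosIn I A B → ¬ (⟦ ∅ , B ⟧ ⊆F (⋂ Q))
      no-cylinder-inside no-diagonal B (posB , B⊆A) B-inside = no-diagonal (B , (posB , B⊆A) , B-diagonal)
        where
        B∈[∅,B] : ⟦ ∅ , B ⟧ B
        B∈[∅,B] = cylinder (Pos⇒Infinite posB) ((λ _ ()) , λ _ _ → inj₂ []) (λ _ → inj₂)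
        B-diagonal : ∀ m → B m → Ds m (B / m)
        B-diagonal m bm with ∈⇒Nth bm
        ... | i , nth with proj₂ (B-inside B B∈[∅,B] i) m nth
        ...   | inj₁ iB/m = ⊥-elim (Pos-/ posB m iB/m)
        ...   | inj₂ dsB/m = dsB/m

    conditionB⇒semiselective : ConditionB I → Semiselective I
    conditionB⇒semiselective cb A posA Ds Ds-denseOpen with em₁ (Backward.Diagonal Ds Ds-denseOpen A)
    ... | inj₁ diagonal    = diagonal
    ... | inj₂ no-diagonal with cb ∅ A posA Q Q-subsetOfInfinite (no-cylinder-inside no-diagonal)
      where open Backward Ds Ds-denseOpen
    ...   | i , (c , c-linked) , C , (posC , _) , _ , |c|≤i , _ , C-strongly-rejects =
      ⊥-elim (Q-meets-every-cylinder (Linked⇒AllPairs <-trans c-linked) posC |c|≤i C-strongly-rejects)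
      where open Backward Ds Ds-denseOpen

lemma3p1 : LEM → (I : Family) → Ideal I → (Semiselective I ⇔ ConditionB I)
lemma3p1 lem I ideal = mk⇔ (semiselective⇒conditionB ideal) (conditionB⇒semiselective ideal)
  where open Classical lem
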